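{- Let $(X,\leq,\top,\ominus)$ be a D-poset with its canonical effect algebra structure $\oplus$ and bottom $\bot$. Define $\mathbb{B}\mathcal{X}$ as follows: objects are the elements of $X$; for $x,y\in X$ the hom-set is $\mathbb{B}\mathcal{X}[x,y]:=\{x\}\times X_{\leq y\ominus x}\times\{y\}$ if $x\leq y$ and $\emptyset$ otherwise; the identity on $x$ is $(x,\bot,x)$; and composition is \[(y,f,z)\circ(x,g,y):=(x,f\oplus g,z).\] Then composition is well defined (i.e. $f\oplus g$ is defined and $f\oplus g\leq z\ominus x$ whenever $f\leq z\ominus y$ and $g\leq y\ominus x$), and $\mathbb{B}\mathcal{X}$ is a category.
   Context: A D-poset $(X,\leq,\top,\ominus)$ is a poset with top element $\top$ and a partial binary operation $\ominus$ such that: (1) $y\ominus x$ is defined precisely when $x\leq y$; (2) whenever $x\leq y$, $y\ominus x\leq y$ and $y\ominus(y\ominus x)=x$; (3) if $z\leq y\leq x$ then $x\ominus y\leq x\ominus z$ and $(x\ominus z)\ominus(x\ominus y)=y\ominus z$. The bottom element is $\bot:=x\ominus x$. The canonical effect algebra structure: $x\oplus y$ is defined iff there is $z$ with $z\ominus y=x$ (equivalently $y\leq\top\ominus x$), and then $x\oplus y:=z$. $X_{\leq b}:=\{t\in X:t\leq b\}$. -}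

module Defs where

open import Level using (Level; _⊔_; suc)
open import Data.Product using (Σ; Σ-syntax; _,_; proj₁; proj₂; _×_)
open import Relation.Binary.Core using (Rel)
open import Relation.Binary.Structures using (IsPartialOrder; IsEquivalence)
open import Relation.Binary.PropositionalEquality using (_≡_)

-- D-posets.  The partial operation ⊖ is y ⊖ x, defined exactly when
-- x ≤ y: it takes an (irrelevant) proof of x ≤ y.

record DPoset (a ℓ : Level) : Set (suc (a ⊔ ℓ)) where
  infix 4 _≤_
  field
    Carrier        : Set a
    _≤_            : Rel Carrier ℓ
    isPartialOrder : IsPartialOrder _≡_ _≤_
    ⊤              : Carrier
    ⊤-max          : ∀ x → x ≤ ⊤
    _⊖_            : (y x : Carrier) → .(x ≤ y) → Carrier
    ⊖-≤            : ∀ {x y} (p : x ≤ y) → (y ⊖ x) p ≤ y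
    ⊖-invol        : ∀ {x y} (p : x ≤ y) → (y ⊖ ((y ⊖ x) p)) (⊖-≤ p) ≡ x
    ⊖-antitone     : ∀ {x y z} (zy : z ≤ y) (yx : y ≤ x) (zx : z ≤ x) →
                     (x ⊖ y) yx ≤ (x ⊖ z) zx
    ⊖-diff         : ∀ {x y z} (zy : z ≤ y) (yx : y ≤ x) (zx : z ≤ x) →
                     ((x ⊖ z) zx ⊖ (x ⊖ y) yx) (⊖-antitone zy yx zx)
                       ≡ (y ⊖ z) zy

  ⊥ : Carrier
  ⊥ = (⊤ ⊖ ⊤) (⊤-max ⊤)

  -- canonical effect algebra structure:  x ⊕ y = z  iff  z ⊖ y = x
  IsSum : Carrier → Carrier → Carrier → Set (a ⊔ ℓ)
  IsSum x y z = Σ (y ≤ z) λ p → (z ⊖ y) p ≡ x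

record IsCategory {o h e : Level} (Obj : Set o) (Hom : Obj → Obj → Set h)
    (_≈_ : ∀ {A B} → Rel (Hom A B) e)
    (id : ∀ A → Hom A A)
    (_∘_ : ∀ {A B C} → Hom B C → Hom A B → Hom A C)
    : Set (o ⊔ h ⊔ e) where
  field
    equiv     : ∀ {A B} → IsEquivalence (_≈_ {A} {B})
    assoc     : ∀ {A B C D} (f : Hom A B) (g : Hom B C) (k : Hom C D) →
                ((k ∘ g) ∘ f) ≈ (k ∘ (g ∘ f))
    identityˡ : ∀ {A B} (f : Hom A B) → (id B ∘ f) ≈ f
    identityʳ : ∀ {A B} (f : Hom A B) → (f ∘ id A) ≈ f
    ∘-resp-≈  : ∀ {A B C} {f f′ : Hom B C} {g g′ : Hom A B} →
                f ≈ f′ → g ≈ g′ → (f ∘ g) ≈ (f′ ∘ g′)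

module BX {a ℓ} (D : DPoset a ℓ) where
  open DPoset D

  -- 𝔹𝒳[x,y] = {x} × X_{≤ y⊖x} × {y} if x ≤ y, ∅ otherwise.
  -- An element is a proof of x ≤ y together with f ∈ X_{≤ y⊖x}.
  Hom : Carrier → Carrier → Set (a ⊔ ℓ)
  Hom x y = Σ (x ≤ y) λ p → Σ Carrier λ f → f ≤ (y ⊖ x) p

  mid : ∀ {x y} → Hom x y → Carrier
  mid (_ , f , _) = f

  -- equality of triples (x,f,y) = (x,f',y)
  _≈_ : ∀ {x y} → Rel (Hom x y) a
  h ≈ h′ = mid h ≡ mid h′

-- Subtraction is injective in its
-- second argument by the involution law, and in its first one after
-- subtracting both sides from ⊤ (axiom 3); hence ⊕ is single-valued. If
-- c ≤ A, g ≤ c and f ≤ A ⊖ c, then A ⊖ ((A ⊖ g) ⊖ f) is f ⊕ g and lies below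
-- A; taking A = z ⊖ x and c = y ⊖ x, whose difference is z ⊖ y, shows that
-- composition is defined. The category laws are then the effect-algebra laws
-- (⊥ is neutral, ⊕ is associative), which hold on the nose because ⊕ is
-- single-valued.
module Submission where

open import Defs
open import Level using (Level)
open import Data.Product using (Σ; Σ-syntax; _,_; _×_; proj₁; proj₂)
open import Relation.Binary.PropositionalEquality
  using (_≡_; refl; sym; trans; subst₂; module ≡-Reasoning)
open import Relation.Binary.Structures using (IsPartialOrder)

module DPosetProperties {a ℓ : Level} (D : DPoset a ℓ) where
  open DPoset D
  open IsPartialOrder isPartialOrder
    using () renaming (refl to ≤-refl; trans to ≤-trans;
                       ≲-respˡ-≈ to ≤-respˡ-≡; ≲-respʳ-≈ to ≤-respʳ-≡)
  open ≡-Reasoning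

  ⊖-cong : ∀ {x x′ y y′} → x ≡ x′ → y ≡ y′ → .(p : y ≤ x) .(p′ : y′ ≤ x′) →
           (x ⊖ y) p ≡ (x′ ⊖ y′) p′
  ⊖-cong refl refl _ _ = refl

  ⊖-injectiveʳ : ∀ {x y y′} (p : y ≤ x) (p′ : y′ ≤ x) →
                 (x ⊖ y) p ≡ (x ⊖ y′) p′ → y ≡ y′
  ⊖-injectiveʳ {x} {y} {y′} p p′ eq = begin
    y                            ≡⟨ sym (⊖-invol p) ⟩
    (x ⊖ (x ⊖ y) p) (⊖-≤ p)      ≡⟨ ⊖-cong refl eq _ _ ⟩
    (x ⊖ (x ⊖ y′) p′) (⊖-≤ p′)   ≡⟨ ⊖-invol p′ ⟩
    y′                           ∎

  ⊖-injectiveˡ : ∀ {x y z} (zx : z ≤ x) (zy : z ≤ y) →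
                 (x ⊖ z) zx ≡ (y ⊖ z) zy → x ≡ y
  ⊖-injectiveˡ {x} {y} {z} zx zy eq =
    ⊖-injectiveʳ (⊤-max x) (⊤-max y)
      (⊖-injectiveʳ (⊖-antitone zx (⊤-max x) (⊤-max z))
                    (⊖-antitone zy (⊤-max y) (⊤-max z))
        (begin
          ((⊤ ⊖ z) _ ⊖ (⊤ ⊖ x) _) _  ≡⟨ ⊖-diff zx (⊤-max x) (⊤-max z) ⟩
          (x ⊖ z) zx                 ≡⟨ eq ⟩
          (y ⊖ z) zy                 ≡⟨ sym (⊖-diff zy (⊤-max y) (⊤-max z)) ⟩
          ((⊤ ⊖ z) _ ⊖ (⊤ ⊖ y) _) _  ∎))

  ⊖-monoˡ : ∀ {x y z} (xy : x ≤ y) (yz : y ≤ z) (xz : x ≤ z) →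
            (y ⊖ x) xy ≤ (z ⊖ x) xz
  ⊖-monoˡ xy yz xz = ≤-respˡ-≡ (⊖-diff xy yz xz) (⊖-≤ (⊖-antitone xy yz xz))

  ⊖-telescope : ∀ {x y z} (xy : x ≤ y) (yz : y ≤ z) (xz : x ≤ z) →
                ((z ⊖ x) xz ⊖ (y ⊖ x) xy) (⊖-monoˡ xy yz xz) ≡ (z ⊖ y) yz
  ⊖-telescope xy yz xz =
    trans (⊖-cong refl (sym (⊖-diff xy yz xz)) _ _) (⊖-invol (⊖-antitone xy yz xz))

  -- ⊥ = ⊤ ⊖ ⊤ ≤ ⊤ ⊖ (⊤ ⊖ t) = t by antitonicity.
  ⊥-min : ∀ t → ⊥ ≤ t
  ⊥-min t = ≤-respʳ-≡ (⊖-invol (⊤-max t))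
              (⊖-antitone (⊤-max ((⊤ ⊖ t) (⊤-max t))) (⊤-max ⊤) (⊤-max _))

  ⊖-⊥ : ∀ t → (t ⊖ ⊥) (⊥-min t) ≡ t
  ⊖-⊥ t = begin
    (t ⊖ ⊥) _                                        ≡⟨ ⊖-cong (sym (⊖-invol (⊤-max t))) refl _ _ ⟩
    ((⊤ ⊖ (⊤ ⊖ t) _) (⊖-≤ (⊤-max t)) ⊖ ⊥) (⊥-min _)  ≡⟨ ⊖-diff (⊤-max _) (⊤-max ⊤) (⊤-max _) ⟩
    (⊤ ⊖ (⊤ ⊖ t) _) (⊤-max _)                        ≡⟨ ⊖-invol (⊤-max t) ⟩
    t                                                ∎

  ⊖-self : ∀ t → (t ⊖ t) ≤-refl ≡ ⊥
  ⊖-self t = trans (⊖-cong refl (sym (⊖-⊥ t)) _ _) (⊖-invol (⊥-min t))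

  IsSum-functional : ∀ {u v w w′} → IsSum u v w → IsSum u v w′ → w ≡ w′
  IsSum-functional (vw , w⊖v≡u) (vw′ , w′⊖v≡u) =
    ⊖-injectiveˡ vw vw′ (trans w⊖v≡u (sym w′⊖v≡u))

  IsSum-comm : ∀ {u v w} → IsSum u v w → IsSum v u w
  IsSum-comm (vw , w⊖v≡u) =
    ≤-respˡ-≡ w⊖v≡u (⊖-≤ vw) , trans (⊖-cong refl (sym w⊖v≡u) _ _) (⊖-invol vw)

  IsSum-identityˡ : ∀ t → IsSum ⊥ t t
  IsSum-identityˡ t = ≤-refl , ⊖-self t

  IsSum-identityʳ : ∀ t → IsSum t ⊥ t
  IsSum-identityʳ t = ⊥-min t , ⊖-⊥ t

  -- k ⊕ (g ⊕ f) = (k ⊕ g) ⊕ f, with k ⊕ g witnessed by n ⊖ f.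
  IsSum-assoc : ∀ {k g f m n} → IsSum g f m → IsSum k m n →
                Σ[ p ∈ Carrier ] (IsSum k g p × IsSum p f n)
  IsSum-assoc {k} {g} {f} {m} {n} (fm , m⊖f≡g) (mn , n⊖m≡k) =
    (n ⊖ f) fn , IsSum-comm (k≤n⊖f , n⊖f⊖k≡g) , (fn , refl)
    where
    fn = ≤-trans fm mn
    k≤n⊖f : k ≤ (n ⊖ f) fn
    k≤n⊖f = ≤-respˡ-≡ n⊖m≡k (⊖-antitone fm mn fn)
    n⊖f⊖k≡g : ((n ⊖ f) fn ⊖ k) k≤n⊖f ≡ g
    n⊖f⊖k≡g = begin
      ((n ⊖ f) fn ⊖ k) k≤n⊖f                              ≡⟨ ⊖-cong refl (sym n⊖m≡k) _ _ ⟩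
      ((n ⊖ f) fn ⊖ (n ⊖ m) mn) (⊖-antitone fm mn fn)     ≡⟨ ⊖-diff fm mn fn ⟩
      (m ⊖ f) fm                                          ≡⟨ m⊖f≡g ⟩
      g                                                   ∎

  sum-below : ∀ {A c f g} (cA : c ≤ A) → g ≤ c → f ≤ (A ⊖ c) cA →
              Σ[ w ∈ Carrier ] (IsSum f g w × w ≤ A)
  sum-below {A} {c} {f} {g} cA gc fAc = w , (gw , w⊖g≡f) , ⊖-≤ hA
    where
    gA = ≤-trans gc cA
    e  = (A ⊖ g) gA
    eA = ⊖-≤ gA
    fe : f ≤ e
    fe = ≤-trans fAc (⊖-antitone gc cA gA)
    h  = (e ⊖ f) fe
    he = ⊖-≤ fe
    hA = ≤-trans he eA
    w  = (A ⊖ h) hA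
    gw : g ≤ w
    gw = ≤-respˡ-≡ (⊖-invol gA) (⊖-antitone he eA hA)
    w⊖g≡f : (w ⊖ g) gw ≡ f
    w⊖g≡f = begin
      (w ⊖ g) gw                              ≡⟨ ⊖-cong refl (sym (⊖-invol gA)) _ _ ⟩
      (w ⊖ (A ⊖ e) eA) (⊖-antitone he eA hA)  ≡⟨ ⊖-diff he eA hA ⟩
      (e ⊖ h) he                              ≡⟨ ⊖-invol fe ⟩
      f                                       ∎

  compose-defined : ∀ {x y z f g} (xy : x ≤ y) (yz : y ≤ z) (xz : x ≤ z) →
                    f ≤ (z ⊖ y) yz → g ≤ (y ⊖ x) xy →
                    Σ[ w ∈ Carrier ] (IsSum f g w × w ≤ (z ⊖ x) xz)
  compose-defined xy yz xz f≤z⊖y g≤y⊖x =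
    sum-below (⊖-monoˡ xy yz xz) g≤y⊖x
              (≤-respʳ-≡ (sym (⊖-telescope xy yz xz)) f≤z⊖y)

  open BX D

  identity : ∀ x → Hom x x
  identity x = ≤-refl , ⊥ , ⊥-min _

  infixr 9 _∘_
  _∘_ : ∀ {x y z} → Hom y z → Hom x y → Hom x z
  (yz , f , f≤z⊖y) ∘ (xy , g , g≤y⊖x) =
    let xz = ≤-trans xy yz
        (w , _ , w≤z⊖x) = compose-defined xy yz xz f≤z⊖y g≤y⊖x
    in xz , w , w≤z⊖x

  ∘-IsSum : ∀ {x y z} (k : Hom y z) (h : Hom x y) → IsSum (mid k) (mid h) (mid (k ∘ h))
  ∘-IsSum (yz , _ , f≤z⊖y) (xy , _ , g≤y⊖x) =
    proj₁ (proj₂ (compose-defined xy yz (≤-trans xy yz) f≤z⊖y g≤y⊖x))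

  ∘-assoc : ∀ {w x y z} (f : Hom w x) (g : Hom x y) (k : Hom y z) →
            ((k ∘ g) ∘ f) ≈ (k ∘ (g ∘ f))
  ∘-assoc f g k =
    let (p , k⊕g≡p , p⊕f≡n) = IsSum-assoc (∘-IsSum g f) (∘-IsSum k (g ∘ f))
        p≡kg = IsSum-functional k⊕g≡p (∘-IsSum k g)
    in IsSum-functional (∘-IsSum (k ∘ g) f)
         (subst₂ (λ u v → IsSum u (mid f) v) p≡kg refl p⊕f≡n)

  ∘-resp-≈ : ∀ {x y z} {f f′ : Hom y z} {g g′ : Hom x y} →
             f ≈ f′ → g ≈ g′ → (f ∘ g) ≈ (f′ ∘ g′)
  ∘-resp-≈ {f = f} {f′} {g} {g′} f≈f′ g≈g′ =
    IsSum-functional (∘-IsSum f g)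
      (subst₂ (λ u v → IsSum u v (mid (f′ ∘ g′))) (sym f≈f′) (sym g≈g′) (∘-IsSum f′ g′))

  isCategory : IsCategory Carrier Hom _≈_ identity _∘_
  isCategory = record
    { equiv     = record { refl = refl ; sym = sym ; trans = trans }
    ; assoc     = ∘-assoc
    ; identityˡ = λ f → IsSum-functional (∘-IsSum (identity _) f) (IsSum-identityˡ (mid f))
    ; identityʳ = λ f → IsSum-functional (∘-IsSum f (identity _)) (IsSum-identityʳ (mid f))
    -- _≈_ only compares mid, so the morphisms cannot be inferred from it.
    ; ∘-resp-≈  = λ {_} {_} {_} {f} {f′} {g} {g′} → ∘-resp-≈ {f = f} {f′} {g} {g′}
    }

mainTheorem2 : ∀ {a ℓ : Level} (D : DPoset a ℓ) →
  let open DPoset D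
      open BX D
  in
  (∀ {u v w w′} → IsSum u v w → IsSum u v w′ → w ≡ w′)
  × (∀ {x y z f g} (xy : x ≤ y) (yz : y ≤ z) (xz : x ≤ z) →
       f ≤ (z ⊖ y) yz → g ≤ (y ⊖ x) xy →
       Σ[ w ∈ Carrier ] (IsSum f g w × w ≤ (z ⊖ x) xz))
  × (Σ[ id ∈ (∀ x → Hom x x) ]
     (Σ[ comp ∈ (∀ {x y z} → Hom y z → Hom x y → Hom x z) ]
       (∀ x → mid (id x) ≡ ⊥)
     × (∀ {x y z} (k : Hom y z) (h : Hom x y) → IsSum (mid k) (mid h) (mid (comp k h)))
     × IsCategory Carrier Hom _≈_ id comp))
mainTheorem2 D =
  IsSum-functional , compose-defined ,
  identity , _∘_ , (λ _ → refl) , ∘-IsSum , isCategory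
  where open DPosetProperties D
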